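{- Let $N\ge 2$. For every $k\in\{0,\dots,N-2\}$ there is a sequence of moves starting from $0^{N-1}=(0,\dots,0)\in\mathbb{N}^{N-1}$ that ends in the (final) state $1^k\,2\,1^{N-2-k}$ (i.e. $k$ ones, then a single $2$, then $N-2-k$ ones).
   Context: A state is a tuple $a=(a_1,\dots,a_m)$ of nonnegative integers; powers denote repetition of an entry. A move from a state $a$ to a state $a'$ is performed as follows: choose a triggering position $T$ with $a_T=0$; set $a'_T=2$; if there exists $j<T$ with $a_j>0$, take the largest such $j$ and set $a'_j=a_j-1$; if there exists $j>T$ with $a_j>0$, take the smallest such $j$ and set $a'_j=a_j-1$; all other entries are unchanged. A state is final if it contains no entry equal to $0$. -}

module Defs where

open import Data.Nat using (ℕ; zero; suc; _<_)
open import Data.List using (List; []; _∷_; _++_; take; drop; length; replicate; reverse; lookup)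
open import Data.Fin using (Fin)
open import Relation.Binary.PropositionalEquality using (_≡_)
open import Relation.Binary.Construct.Closure.ReflexiveTransitive using (Star)

State : Set
State = List ℕ

decFirst : State → State
decFirst []            = []
decFirst (zero  ∷ xs)  = zero ∷ decFirst xs
decFirst (suc x ∷ xs)  = x ∷ xs

decLast : State → State
decLast xs = reverse (decFirst (reverse xs))

-- Result of a move triggered at position T (0-indexed).
fire : State → ℕ → State
fire a T = decLast (take T a) ++ (2 ∷ decFirst (drop (suc T) a))

data Move : State → State → Set where
  move : (a : State) (T : Fin (length a)) → lookup a T ≡ 0 →
         Move a (fire a (Data.Fin.toℕ T))

Moves : State → State → Set
Moves = Star Move

{-# OPTIONS --safe #-}
-- Start by firing position b = N − 2 − k of the zero state. Firing the 0 just left of the 2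
-- turns that 2 into a 1, so sweeping leftwards reaches 2 1^b 0^k. Firing the first 0 after
-- 2 1^p turns the last 1 of the block into a 0 with a 2 behind it; firing each new 0 in turn
-- walks this hole back to the 2, and the net effect is 1^a 2 1^p 0 ↦ 1^(a+1) 2 1^p (the
-- trailing zeros are never decremented). Doing this k times gives 1^k 2 1^b.
module Submission where

open import Defs
open import Data.Nat using (ℕ; _∸_; _≤_; zero; suc; _+_; s≤s)
open import Data.Nat.Properties using (+-suc; +-identityʳ; m∸n+n≡m)
open import Data.List using ([]; _∷_; _++_; [_]; replicate; take; drop; length; lookup; reverse)
open import Data.List.Properties using (++-assoc; ++-identityʳ; reverse-++; unfold-reverse; reverse-involutive)
open import Data.Fin using (Fin; toℕ)
import Data.Fin as Fin
open import Relation.Binary.PropositionalEquality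
  using (_≡_; refl; sym; trans; cong; cong₂; subst; module ≡-Reasoning)
open import Relation.Binary.Construct.Closure.ReflexiveTransitive using (ε)
open import Relation.Binary.Construct.Closure.ReflexiveTransitive.Properties using (module StarReasoning)

replicate-++-∷ : ∀ n (x : ℕ) ys → replicate n x ++ x ∷ ys ≡ replicate (suc n) x ++ ys
replicate-++-∷ zero    x ys = refl
replicate-++-∷ (suc n) x ys = cong (x ∷_) (replicate-++-∷ n x ys)

replicate-+ : ∀ m n (x : ℕ) → replicate (m + n) x ≡ replicate m x ++ replicate n x
replicate-+ zero    n x = refl
replicate-+ (suc m) n x = cong (x ∷_) (replicate-+ m n x)

reverse-replicate : ∀ n (x : ℕ) → reverse (replicate n x) ≡ replicate n x
reverse-replicate zero    x = refl
reverse-replicate (suc n) x = begin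
  reverse (x ∷ replicate n x)  ≡⟨ unfold-reverse x (replicate n x) ⟩
  reverse (replicate n x) ++ [ x ] ≡⟨ cong (_++ [ x ]) (reverse-replicate n x) ⟩
  replicate n x ++ [ x ]       ≡⟨ replicate-++-∷ n x [] ⟩
  replicate (suc n) x ++ []    ≡⟨ ++-identityʳ _ ⟩
  replicate (suc n) x          ∎
  where open ≡-Reasoning

decFirst-zeros : ∀ n → decFirst (replicate n 0) ≡ replicate n 0
decFirst-zeros zero    = refl
decFirst-zeros (suc n) = cong (0 ∷_) (decFirst-zeros n)

decLast-zeros : ∀ n → decLast (replicate n 0) ≡ replicate n 0
decLast-zeros n = begin
  reverse (decFirst (reverse (replicate n 0))) ≡⟨ cong (λ xs → reverse (decFirst xs)) (reverse-replicate n 0) ⟩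
  reverse (decFirst (replicate n 0))           ≡⟨ cong reverse (decFirst-zeros n) ⟩
  reverse (replicate n 0)                      ≡⟨ reverse-replicate n 0 ⟩
  replicate n 0                                ∎
  where open ≡-Reasoning

decLast-∷ʳ-suc : ∀ xs x → decLast (xs ++ [ suc x ]) ≡ xs ++ [ x ]
decLast-∷ʳ-suc xs x = begin
  reverse (decFirst (reverse (xs ++ [ suc x ])))
    ≡⟨ cong (λ ys → reverse (decFirst ys)) (reverse-++ xs [ suc x ]) ⟩
  reverse (x ∷ reverse xs)      ≡⟨ unfold-reverse x (reverse xs) ⟩
  reverse (reverse xs) ++ [ x ] ≡⟨ cong (_++ [ x ]) (reverse-involutive xs) ⟩
  xs ++ [ x ]                   ∎
  where open ≡-Reasoning

position : (xs : State) (x : ℕ) (ys : State) → Fin (length (xs ++ x ∷ ys))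
position []       x ys = Fin.zero
position (_ ∷ xs) x ys = Fin.suc (position xs x ys)

lookup-position : ∀ xs x ys → lookup (xs ++ x ∷ ys) (position xs x ys) ≡ x
lookup-position []       x ys = refl
lookup-position (_ ∷ xs) x ys = lookup-position xs x ys

toℕ-position : ∀ xs x ys → toℕ (position xs x ys) ≡ length xs
toℕ-position []       x ys = refl
toℕ-position (_ ∷ xs) x ys = cong suc (toℕ-position xs x ys)

fire-length : ∀ xs x ys → fire (xs ++ x ∷ ys) (length xs) ≡ decLast xs ++ 2 ∷ decFirst ys
fire-length xs x ys = cong₂ (λ l r → decLast l ++ 2 ∷ decFirst r) (take-length xs) (drop-length xs)
  where
  take-length : ∀ xs → take (length xs) (xs ++ x ∷ ys) ≡ xs
  take-length []       = refl
  take-length (z ∷ xs) = cong (z ∷_) (take-length xs)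
  drop-length : ∀ xs → drop (suc (length xs)) (xs ++ x ∷ ys) ≡ ys
  drop-length []       = refl
  drop-length (_ ∷ xs) = drop-length xs

move-at : ∀ xs ys → Move (xs ++ 0 ∷ ys) (decLast xs ++ 2 ∷ decFirst ys)
move-at xs ys = subst (Move (xs ++ 0 ∷ ys))
  (trans (cong (fire (xs ++ 0 ∷ ys)) (toℕ-position xs 0 ys)) (fire-length xs 0 ys))
  (move (xs ++ 0 ∷ ys) (position xs 0 ys) (lookup-position xs 0 ys))

open StarReasoning Move

sweep-left : ∀ j ys → Moves (replicate j 0 ++ 2 ∷ ys) (2 ∷ replicate j 1 ++ ys)
sweep-left zero    ys = ε
sweep-left (suc j) ys = begin
  replicate (suc j) 0 ++ 2 ∷ ys  ≡⟨ sym (replicate-++-∷ j 0 (2 ∷ ys)) ⟩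
  replicate j 0 ++ 0 ∷ 2 ∷ ys    ⟶⟨ move-at (replicate j 0) (2 ∷ ys) ⟩
  decLast (replicate j 0) ++ 2 ∷ 1 ∷ ys ≡⟨ cong (_++ 2 ∷ 1 ∷ ys) (decLast-zeros j) ⟩
  replicate j 0 ++ 2 ∷ 1 ∷ ys    ⟶*⟨ sweep-left j (1 ∷ ys) ⟩
  2 ∷ replicate j 1 ++ 1 ∷ ys    ≡⟨ cong (2 ∷_) (replicate-++-∷ j 1 ys) ⟩
  2 ∷ replicate (suc j) 1 ++ ys  ∎

shift-two-right : ∀ ws p ys →
  Moves (ws ++ 2 ∷ replicate p 1 ++ 0 ∷ ys) (ws ++ 1 ∷ 2 ∷ replicate p 1 ++ decFirst ys)
shift-two-right ws zero ys = begin
  ws ++ 2 ∷ 0 ∷ ys                       ≡⟨ sym (++-assoc ws [ 2 ] (0 ∷ ys)) ⟩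
  (ws ++ [ 2 ]) ++ 0 ∷ ys                ⟶⟨ move-at (ws ++ [ 2 ]) ys ⟩
  decLast (ws ++ [ 2 ]) ++ 2 ∷ decFirst ys ≡⟨ cong (_++ 2 ∷ decFirst ys) (decLast-∷ʳ-suc ws 1) ⟩
  (ws ++ [ 1 ]) ++ 2 ∷ decFirst ys       ≡⟨ ++-assoc ws [ 1 ] (2 ∷ decFirst ys) ⟩
  ws ++ 1 ∷ 2 ∷ decFirst ys              ∎
shift-two-right ws (suc p) ys = begin
  ws ++ 2 ∷ replicate (suc p) 1 ++ 0 ∷ ys
    ≡⟨ cong (λ zs → ws ++ 2 ∷ zs) (sym (replicate-++-∷ p 1 (0 ∷ ys))) ⟩
  ws ++ 2 ∷ replicate p 1 ++ 1 ∷ 0 ∷ ys   ≡⟨ sym (regroup 1 (0 ∷ ys)) ⟩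
  (us ++ [ 1 ]) ++ 0 ∷ ys                 ⟶⟨ move-at (us ++ [ 1 ]) ys ⟩
  decLast (us ++ [ 1 ]) ++ 2 ∷ decFirst ys ≡⟨ cong (_++ 2 ∷ decFirst ys) (decLast-∷ʳ-suc us 0) ⟩
  (us ++ [ 0 ]) ++ 2 ∷ decFirst ys        ≡⟨ regroup 0 (2 ∷ decFirst ys) ⟩
  ws ++ 2 ∷ replicate p 1 ++ 0 ∷ 2 ∷ decFirst ys ⟶*⟨ shift-two-right ws p (2 ∷ decFirst ys) ⟩
  ws ++ 1 ∷ 2 ∷ replicate p 1 ++ 1 ∷ decFirst ys
    ≡⟨ cong (λ zs → ws ++ 1 ∷ 2 ∷ zs) (replicate-++-∷ p 1 (decFirst ys)) ⟩
  ws ++ 1 ∷ 2 ∷ replicate (suc p) 1 ++ decFirst ys ∎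
  where
  us : State
  us = ws ++ 2 ∷ replicate p 1
  regroup : ∀ x zs → (us ++ [ x ]) ++ zs ≡ ws ++ 2 ∷ replicate p 1 ++ x ∷ zs
  regroup x zs = trans (++-assoc us [ x ] zs) (++-assoc ws (2 ∷ replicate p 1) (x ∷ zs))

fill-zeros : ∀ a b c →
  Moves (replicate a 1 ++ 2 ∷ replicate b 1 ++ replicate c 0) (replicate (a + c) 1 ++ 2 ∷ replicate b 1)
fill-zeros a b zero = begin
  replicate a 1 ++ 2 ∷ replicate b 1 ++ []
    ≡⟨ cong₂ (λ n zs → replicate n 1 ++ 2 ∷ zs) (sym (+-identityʳ a)) (++-identityʳ _) ⟩
  replicate (a + 0) 1 ++ 2 ∷ replicate b 1 ∎
fill-zeros a b (suc c) = begin
  replicate a 1 ++ 2 ∷ replicate b 1 ++ 0 ∷ replicate c 0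
    ⟶*⟨ shift-two-right (replicate a 1) b (replicate c 0) ⟩
  replicate a 1 ++ 1 ∷ 2 ∷ replicate b 1 ++ decFirst (replicate c 0)
    ≡⟨ cong (λ zs → replicate a 1 ++ 1 ∷ 2 ∷ replicate b 1 ++ zs) (decFirst-zeros c) ⟩
  replicate a 1 ++ 1 ∷ 2 ∷ replicate b 1 ++ replicate c 0
    ≡⟨ replicate-++-∷ a 1 (2 ∷ replicate b 1 ++ replicate c 0) ⟩
  replicate (suc a) 1 ++ 2 ∷ replicate b 1 ++ replicate c 0 ⟶*⟨ fill-zeros (suc a) b c ⟩
  replicate (suc a + c) 1 ++ 2 ∷ replicate b 1
    ≡⟨ cong (λ n → replicate n 1 ++ 2 ∷ replicate b 1) (sym (+-suc a c)) ⟩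
  replicate (a + suc c) 1 ++ 2 ∷ replicate b 1 ∎

mainTheorem5 : (N : ℕ) → 2 ≤ N → (k : ℕ) → k ≤ N ∸ 2 →
    Moves (replicate (N ∸ 1) 0) (replicate k 1 ++ (2 ∷ replicate (N ∸ 2 ∸ k) 1))
mainTheorem5 (suc (suc m)) _ k k≤m = begin
  replicate (suc m) 0
    ≡⟨ cong (λ n → replicate n 0) (trans (cong suc (sym (m∸n+n≡m k≤m))) (sym (+-suc b k))) ⟩
  replicate (b + suc k) 0                 ≡⟨ replicate-+ b (suc k) 0 ⟩
  replicate b 0 ++ 0 ∷ replicate k 0      ⟶⟨ move-at (replicate b 0) (replicate k 0) ⟩
  decLast (replicate b 0) ++ 2 ∷ decFirst (replicate k 0)
    ≡⟨ cong₂ (λ xs ys → xs ++ 2 ∷ ys) (decLast-zeros b) (decFirst-zeros k) ⟩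
  replicate b 0 ++ 2 ∷ replicate k 0      ⟶*⟨ sweep-left b (replicate k 0) ⟩
  2 ∷ replicate b 1 ++ replicate k 0      ⟶*⟨ fill-zeros 0 b k ⟩
  replicate k 1 ++ 2 ∷ replicate b 1      ∎
  where
  b : ℕ
  b = m ∸ k
mainTheorem5 (suc zero) (s≤s ()) _ _
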